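{- For any integers $0 < \delta \leq \Delta$, the set $\mathcal{G}_{\delta,\Delta}$ is nonempty. Moreover, if $G$ is a graph with minimum degree $\delta$ and maximum degree $\Delta$, then $$|E(G)| \geq \frac{\Delta(\delta+1)}{2} \text{ if } \Delta(\delta+1) \text{ is even}, \qquad |E(G)| \geq \frac{\Delta(\delta+1)+1}{2} \text{ if } \Delta(\delta+1) \text{ is odd},$$ with equality if and only if $G \in \mathcal{G}_{\delta,\Delta}$.
   Context: All graphs are finite, simple (no loops or multiple edges) and have at least one edge. For integers $0 < \delta \leq \Delta$, $\mathcal{G}_{\delta,\Delta}$ denotes the set of graphs $G$ with minimum degree $\delta$ and maximum degree $\Delta$ such that: (1) if $\delta = \Delta$, $G$ is isomorphic to the complete graph $K_{\Delta+1}$; (2) if $\delta < \Delta$ and $\Delta(\delta+1)$ is even, $|V(G)| = \Delta + 1$ and there are $\Delta$ vertices of degree $\delta$; (3) if $\delta < \Delta - 1$ and $\Delta(\delta+1)$ is odd, $|V(G)| = \Delta+1$, there are $\Delta - 1$ vertices of degree $\delta$ and one vertex of degree $\delta+1$; (4) if $\delta = \Delta - 1$ and $\Delta$ is odd, $|V(G)| = \Delta + 1$, there are $\Delta - 1$ vertices of degree $\delta$ and two vertices of degree $\Delta$. -}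

module Defs where

open import Data.Nat using (ℕ; zero; suc; _+_; _*_; _∸_; _<_; _≤_)
open import Data.Fin using (Fin; toℕ)
open import Data.Bool using (Bool; true; false; if_then_else_; _∧_)
open import Data.Product using (Σ; ∃; ∃-syntax; _×_; _,_)
open import Data.Sum using (_⊎_)
open import Data.Nat.Divisibility using (_∣_)
open import Relation.Nullary using (¬_; does)
open import Relation.Binary.PropositionalEquality using (_≡_; _≢_)
open import Function.Bundles using (_↔_; Inverse)
import Data.Nat as ℕ
import Data.Bool
import Data.Fin

countFin : ∀ {n} → (Fin n → Bool) → ℕ
countFin {zero} p = 0
countFin {suc n} p = (if p Data.Fin.zero then 1 else 0) + countFin (λ i → p (Data.Fin.suc i))

-- A finite simple graph on vertex set Fin n (no loops, symmetric adjacency),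
-- with at least one edge (standing convention of the paper).
record Graph : Set where
  field
    n       : ℕ
    adj     : Fin n → Fin n → Bool
    sym     : ∀ i j → adj i j ≡ adj j i
    irrefl  : ∀ i → adj i i ≡ false
    hasEdge : ∃[ i ] ∃[ j ] adj i j ≡ true

open Graph public

order : Graph → ℕ
order G = n G

degree : (G : Graph) → Fin (n G) → ℕ
degree G i = countFin (adj G i)

sumFin : ∀ {n} → (Fin n → ℕ) → ℕ
sumFin {zero} f = 0
sumFin {suc n} f = f Data.Fin.zero + sumFin (λ i → f (Data.Fin.suc i))

edgeCount : Graph → ℕ
edgeCount G = sumFin (λ i → countFin (λ j → does (toℕ i ℕ.<? toℕ j) ∧ adj G i j))

MinDegree : Graph → ℕ → Set
MinDegree G δ = (∀ i → δ ≤ degree G i) × (∃[ i ] degree G i ≡ δ)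

MaxDegree : Graph → ℕ → Set
MaxDegree G Δ = (∀ i → degree G i ≤ Δ) × (∃[ i ] degree G i ≡ Δ)

numDeg : (G : Graph) → ℕ → ℕ
numDeg G d = countFin (λ i → does (degree G i ℕ.≟ d))

-- the complete graph K_m is represented only through the adjacency relation
-- (it has no edge when m ≤ 1, so it is not a `Graph` record in general)
completeAdj : (m : ℕ) → Fin m → Fin m → Bool
completeAdj m i j = Data.Bool.not (does (i Data.Fin.≟ j))

IsoComplete : Graph → ℕ → Set
IsoComplete G m = Σ (Fin (n G) ↔ Fin m) λ f →
  ∀ i j → adj G i j ≡ completeAdj m (Inverse.to f i) (Inverse.to f j)

InClass : ℕ → ℕ → Graph → Set
InClass δ Δ G =
  MinDegree G δ × MaxDegree G Δ ×
  (  (δ ≡ Δ × IsoComplete G (suc Δ))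
   ⊎ (δ < Δ × (2 ∣ Δ * suc δ) × order G ≡ suc Δ × numDeg G δ ≡ Δ)
   ⊎ (suc δ < Δ × ¬ (2 ∣ Δ * suc δ) × order G ≡ suc Δ
        × numDeg G δ ≡ Δ ∸ 1 × numDeg G (suc δ) ≡ 1)
   ⊎ (suc δ ≡ Δ × ¬ (2 ∣ Δ) × order G ≡ suc Δ
        × numDeg G δ ≡ Δ ∸ 1 × numDeg G Δ ≡ 2))

module Submission where

-- Let v be a vertex of degree Δ. Its Δ neighbours show that the order is Δ + 1 + t for some t, and
-- the handshake lemma gives
--   2|E| = Σ deg = Δ(δ+1) + tδ + Σ_{i ≠ v} (deg i − δ),
-- so 2|E| ≥ Δ(δ+1), with equality exactly when the order is Δ + 1 and every vertex other than v has
-- degree δ. When Δ(δ+1) is odd, δ is even and hence at least 2, so 2|E| = Δ(δ+1) + 1 forces t = 0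
-- and a single vertex other than v of degree δ + 1. Counting vertices by degree shows that these
-- degree profiles are exactly the defining conditions of 𝒢_{δ,Δ}; for δ = Δ the profile describes a
-- Δ-regular graph on Δ + 1 vertices, i.e. the complete graph.
-- Conversely, the profiles are realised by an apex joined to a graph on Δ vertices whose degrees are
-- all δ − 1 or, when Δ and δ − 1 are odd, all δ − 1 except one vertex of degree δ. For the former
-- take the circulant with jumps 1, …, k if δ − 1 = 2k, and otherwise (Δ even) the complement of a
-- circulant; for the latter, the complement of the union of a circulant on Δ = 2h + 1 vertices
-- with jumps up to k < h and the matching x ↔ x + h (1 ≤ x ≤ h), whose pairs are at cyclic distance h.

open import Defs hiding (sym)
open import Data.Nat
  using (ℕ; zero; suc; _+_; _*_; _∸_; _%_; _<_; _≤_; z≤n; s≤s; s≤s⁻¹; _≟_; _<?_; _≤?_; NonZero)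
open import Data.Nat.DivMod using (_mod_; %-distribˡ-+; m%n%n≡m%n; [m+n]%n≡m%n; m<n⇒m%n≡m; m%n<n; n%n≡0)
open import Data.Nat.Properties
open import Data.Nat.Divisibility
  using (_∣_; divides; n∣m*n; m∣m*n; ∣m⇒∣m*n; ∣n⇒∣m*n; ∣m+n∣m⇒∣n; ∣1⇒≡1)
open import Data.Nat.Primality using (euclidsLemma; prime[2])
open import Data.Fin using (Fin; toℕ) renaming (zero to fzero; suc to fsuc)
import Data.Fin as Fin
import Data.Fin.Properties as Fin
open import Data.Fin.Permutation using (Permutation; Permutation′; _⟨$⟩ʳ_; cast-id; permutation; reverse)
open import Data.Bool using (Bool; true; false; if_then_else_; _∧_; _∨_; not)
open import Data.Bool.Properties using (∧-zeroʳ; ∧-identityʳ; ∨-comm)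
open import Relation.Binary.Definitions using (tri<; tri≈; tri>)
open import Data.Product using (∃-syntax; _×_; _,_; proj₁; proj₂)
open import Data.Sum using (_⊎_; inj₁; inj₂; [_,_]) renaming (swap to ⊎-swap)
open import Function using (_∘_)
open import Function.Bundles using (_⇔_; mk⇔; Equivalence; Inverse; Injection)
open import Function.Properties.Inverse using (↔⇒↣)
open import Function.Properties.Equivalence using () renaming (trans to ⇔-trans; sym to ⇔-sym)
open import Relation.Nullary using (¬_; Dec; does; yes; no; contradiction)
open import Relation.Nullary.Decidable using (dec-true; dec-false; does-⇔; _×-dec_; _⊎-dec_)
open import Relation.Binary.PropositionalEquality
  using (_≡_; _≢_; refl; sym; trans; cong; cong₂; subst; module ≡-Reasoning)
open import Algebra.Properties.CommutativeMonoid.Sum +-0-commutativeMonoid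
  using (sum; ∑-distrib-+; ∑-comm; sum-permute)
open import Algebra.Properties.CommutativeSemigroup +-commutativeSemigroup using (x∙yz≈y∙xz)
open import Data.Nat.Tactic.RingSolver using (solve-∀)

sumFin≡sum : ∀ {n} (f : Fin n → ℕ) → sumFin f ≡ sum f
sumFin≡sum {zero}  f = refl
sumFin≡sum {suc n} f = cong (f fzero +_) (sumFin≡sum (f ∘ fsuc))

sumFin-cong : ∀ {n} {f g : Fin n → ℕ} → (∀ i → f i ≡ g i) → sumFin f ≡ sumFin g
sumFin-cong {zero}  f≗g = refl
sumFin-cong {suc n} f≗g = cong₂ _+_ (f≗g fzero) (sumFin-cong (f≗g ∘ fsuc))

sumFin-+ : ∀ {n} (f g : Fin n → ℕ) → sumFin (λ i → f i + g i) ≡ sumFin f + sumFin g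
sumFin-+ f g = begin
  sumFin (λ i → f i + g i) ≡⟨ sumFin≡sum (λ i → f i + g i) ⟩
  sum (λ i → f i + g i)    ≡⟨ ∑-distrib-+ f g ⟩
  sum f + sum g            ≡⟨ sym (cong₂ _+_ (sumFin≡sum f) (sumFin≡sum g)) ⟩
  sumFin f + sumFin g      ∎
  where open ≡-Reasoning

sumFin-comm : ∀ {m n} (f : Fin m → Fin n → ℕ) →
              sumFin (λ i → sumFin (f i)) ≡ sumFin (λ j → sumFin (λ i → f i j))
sumFin-comm f = begin
  sumFin (λ i → sumFin (f i))              ≡⟨ sumFin-cong (λ i → sumFin≡sum (f i)) ⟩
  sumFin (λ i → sum (f i))                 ≡⟨ sumFin≡sum (λ i → sum (f i)) ⟩
  sum (λ i → sum (f i))                    ≡⟨ ∑-comm f ⟩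
  sum (λ j → sum (λ i → f i j))            ≡⟨ sym (sumFin≡sum (λ j → sum (λ i → f i j))) ⟩
  sumFin (λ j → sum (λ i → f i j))         ≡⟨ sumFin-cong (λ j → sym (sumFin≡sum (λ i → f i j))) ⟩
  sumFin (λ j → sumFin (λ i → f i j))      ∎
  where open ≡-Reasoning

sumFin-permute : ∀ {n} (f : Fin n → ℕ) (π : Permutation′ n) → sumFin f ≡ sumFin (f ∘ (π ⟨$⟩ʳ_))
sumFin-permute f π = begin
  sumFin f              ≡⟨ sumFin≡sum f ⟩
  sum f                 ≡⟨ sum-permute f π ⟩
  sum (f ∘ (π ⟨$⟩ʳ_))    ≡⟨ sym (sumFin≡sum (f ∘ (π ⟨$⟩ʳ_))) ⟩
  sumFin (f ∘ (π ⟨$⟩ʳ_)) ∎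
  where open ≡-Reasoning

sumFin-const : ∀ n c → sumFin {n} (λ _ → c) ≡ n * c
sumFin-const zero    c = refl
sumFin-const (suc n) c = cong (c +_) (sumFin-const n c)

sumFin≡0⇔ : ∀ {n} {f : Fin n → ℕ} → sumFin f ≡ 0 ⇔ (∀ i → f i ≡ 0)
sumFin≡0⇔ {n} {f} = mk⇔ (to n f) (from n f)
  where
  to : ∀ n (f : Fin n → ℕ) → sumFin f ≡ 0 → ∀ i → f i ≡ 0
  to (suc n) f Σ≡0 fzero    = m+n≡0⇒m≡0 (f fzero) Σ≡0
  to (suc n) f Σ≡0 (fsuc i) = to n (f ∘ fsuc) (m+n≡0⇒n≡0 (f fzero) Σ≡0) i
  from : ∀ n (f : Fin n → ℕ) → (∀ i → f i ≡ 0) → sumFin f ≡ 0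
  from zero    f f≡0 = refl
  from (suc n) f f≡0 = cong₂ _+_ (f≡0 fzero) (from n (f ∘ fsuc) (f≡0 ∘ fsuc))

erase : ∀ {n} → Fin n → (Fin n → ℕ) → Fin n → ℕ
erase k f i = if does (i Fin.≟ k) then 0 else f i

erase-self : ∀ {n} (k : Fin n) f → erase k f k ≡ 0
erase-self k f rewrite dec-true (k Fin.≟ k) refl = refl

erase-other : ∀ {n} {k i : Fin n} f → i ≢ k → erase k f i ≡ f i
erase-other {k = k} {i} f i≢k rewrite dec-false (i Fin.≟ k) i≢k = refl

sumFin-erase : ∀ {n} (f : Fin n → ℕ) k → sumFin f ≡ f k + sumFin (erase k f)
sumFin-erase f fzero = cong (f fzero +_) (sym (begin
  erase fzero f fzero + sumFin (erase fzero f ∘ fsuc)  ≡⟨ cong (_+ sumFin (erase fzero f ∘ fsuc)) (erase-self fzero f) ⟩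
  sumFin (erase fzero f ∘ fsuc)                        ≡⟨ sumFin-cong (λ i → erase-other f (fsuc≢0 i)) ⟩
  sumFin (f ∘ fsuc)                                    ∎))
  where
  open ≡-Reasoning
  fsuc≢0 : ∀ i → fsuc i ≢ fzero
  fsuc≢0 i ()
sumFin-erase f (fsuc k) = begin
  f fzero + sumFin (f ∘ fsuc)                            ≡⟨ cong (f fzero +_) (sumFin-erase (f ∘ fsuc) k) ⟩
  f fzero + (f (fsuc k) + sumFin (erase k (f ∘ fsuc)))   ≡⟨ x∙yz≈y∙xz (f fzero) (f (fsuc k)) _ ⟩
  f (fsuc k) + (f fzero + sumFin (erase k (f ∘ fsuc)))   ≡⟨ cong (f (fsuc k) +_) (cong₂ _+_
                                                               (sym (erase-other {k = fsuc k} {i = fzero} f (λ ())))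
                                                               (sumFin-cong shift)) ⟩
  f (fsuc k) + sumFin (erase (fsuc k) f)                 ∎
  where
  open ≡-Reasoning
  shift : ∀ i → erase k (f ∘ fsuc) i ≡ erase (fsuc k) f (fsuc i)
  shift i with i Fin.≟ k
  ... | yes _ = refl
  ... | no  _ = refl

sumFin-erase≡0⇔ : ∀ {n} (f : Fin n → ℕ) k → sumFin (erase k f) ≡ 0 ⇔ (∀ i → i ≢ k → f i ≡ 0)
sumFin-erase≡0⇔ f k = mk⇔
  (λ Σ≡0 i i≢k → trans (sym (erase-other f i≢k)) (Equivalence.to sumFin≡0⇔ Σ≡0 i))
  (λ f≡0 → Equivalence.from sumFin≡0⇔ (erased≡0 f≡0))
  where
  erased≡0 : (∀ i → i ≢ k → f i ≡ 0) → ∀ i → erase k f i ≡ 0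
  erased≡0 f≡0 i with i Fin.≟ k
  ... | yes _   = refl
  ... | no  i≢k = f≡0 i i≢k

sumFin≡term⇔ : ∀ {n} (f : Fin n → ℕ) k → sumFin f ≡ f k ⇔ (∀ i → i ≢ k → f i ≡ 0)
sumFin≡term⇔ f k = mk⇔
  (λ Σ≡fk → Equivalence.to (sumFin-erase≡0⇔ f k)
     (+-cancelˡ-≡ (f k) _ _ (trans (sym (sumFin-erase f k)) (trans Σ≡fk (sym (+-identityʳ (f k)))))))
  (λ f≡0 → trans (sumFin-erase f k)
     (trans (cong (f k +_) (Equivalence.from (sumFin-erase≡0⇔ f k) f≡0)) (+-identityʳ (f k))))

sumFin≡two-terms⇔ : ∀ {n} (f : Fin n → ℕ) {k l} → l ≢ k →
                    sumFin f ≡ f k + f l ⇔ (∀ i → i ≢ k → i ≢ l → f i ≡ 0)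
sumFin≡two-terms⇔ f {k} {l} l≢k = mk⇔
  (λ Σ≡ i i≢k i≢l → trans (sym (erase-other f i≢k))
     (Equivalence.to (sumFin≡term⇔ (erase k f) l) (restFromSum Σ≡) i i≢l))
  (λ f≡0 → trans (sumFin-erase f k) (cong (f k +_) (trans
     (Equivalence.from (sumFin≡term⇔ (erase k f) l) (restZero f≡0)) (erase-other f l≢k))))
  where
  restFromSum : sumFin f ≡ f k + f l → sumFin (erase k f) ≡ erase k f l
  restFromSum Σ≡ = trans (+-cancelˡ-≡ (f k) _ _ (trans (sym (sumFin-erase f k)) Σ≡))
                         (sym (erase-other f l≢k))
  restZero : (∀ i → i ≢ k → i ≢ l → f i ≡ 0) → ∀ i → i ≢ l → erase k f i ≡ 0
  restZero f≡0 i i≢l with i Fin.≟ k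
  ... | yes _   = refl
  ... | no  i≢k = f≡0 i i≢k i≢l

sumFin≡1⇒ : ∀ {n} (f : Fin n → ℕ) → sumFin f ≡ 1 → ∃[ w ] f w ≡ 1 × (∀ i → i ≢ w → f i ≡ 0)
sumFin≡1⇒ {suc n} f Σ≡1 with f fzero in f₀
... | 0 with sumFin≡1⇒ (f ∘ fsuc) Σ≡1
...   | w , fw≡1 , rest = fsuc w , fw≡1 , others
  where
  others : ∀ i → i ≢ fsuc w → f i ≡ 0
  others fzero    _   = f₀
  others (fsuc i) i≢w = rest i (i≢w ∘ cong fsuc)
sumFin≡1⇒ {suc n} f Σ≡1 | 1 = fzero , f₀ , others
  where
  others : ∀ i → i ≢ fzero → f i ≡ 0
  others fzero    0≢0 = contradiction refl 0≢0
  others (fsuc i) _   = Equivalence.to sumFin≡0⇔ (suc-injective Σ≡1) i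
sumFin≡1⇒ {suc n} f Σ≡1 | suc (suc _) = contradiction Σ≡1 (λ ())

sumFin>0⇒ : ∀ {n} (f : Fin n → ℕ) → 0 < sumFin f → ∃[ i ] 0 < f i
sumFin>0⇒ {suc n} f Σ>0 with f fzero in f₀
... | suc _ = fzero , subst (0 <_) (sym f₀) (s≤s z≤n)
... | zero with sumFin>0⇒ (f ∘ fsuc) Σ>0
...   | i , fi>0 = fsuc i , fi>0

fromBool : Bool → ℕ
fromBool b = if b then 1 else 0

fromBool≡0⇔ : ∀ {b} → fromBool b ≡ 0 ⇔ b ≡ false
fromBool≡0⇔ {false} = mk⇔ (λ _ → refl) (λ _ → refl)
fromBool≡0⇔ {true}  = mk⇔ (λ ()) (λ ())

countFin≡sumFin : ∀ {n} (q : Fin n → Bool) → countFin q ≡ sumFin (fromBool ∘ q)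
countFin≡sumFin {zero}  q = refl
countFin≡sumFin {suc n} q = cong (fromBool (q fzero) +_) (countFin≡sumFin (q ∘ fsuc))

countFin-complement : ∀ {n} (q : Fin n → Bool) → countFin q + countFin (not ∘ q) ≡ n
countFin-complement {n} q = begin
  countFin q + countFin (not ∘ q)
    ≡⟨ cong₂ _+_ (countFin≡sumFin q) (countFin≡sumFin (not ∘ q)) ⟩
  sumFin (fromBool ∘ q) + sumFin (fromBool ∘ not ∘ q)
    ≡⟨ sym (sumFin-+ (fromBool ∘ q) (fromBool ∘ not ∘ q)) ⟩
  sumFin (λ i → fromBool (q i) + fromBool (not (q i)))
    ≡⟨ sumFin-cong (λ i → one (q i)) ⟩
  sumFin {n} (λ _ → 1)
    ≡⟨ sumFin-const n 1 ⟩
  n * 1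
    ≡⟨ *-identityʳ n ⟩
  n ∎
  where
  open ≡-Reasoning
  one : ∀ b → fromBool b + fromBool (not b) ≡ 1
  one true  = refl
  one false = refl

countFin>0⇒ : ∀ {n} (q : Fin n → Bool) → 0 < countFin q → ∃[ i ] q i ≡ true
countFin>0⇒ q count>0 with sumFin>0⇒ (fromBool ∘ q) (subst (0 <_) (countFin≡sumFin q) count>0)
... | i , qi>0 with q i in qi
...   | true  = i , qi
...   | false = contradiction qi>0 (<-irrefl refl)

countFin-another : ∀ {n} (q : Fin n → Bool) {k} → q k ≡ true → 1 < countFin q →
                   ∃[ l ] l ≢ k × q l ≡ true
countFin-another q {k} qk count>1 with sumFin>0⇒ (erase k (fromBool ∘ q)) rest>0
  where
  rest>0 : 0 < sumFin (erase k (fromBool ∘ q))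
  rest>0 = +-cancelˡ-< 1 0 _ (subst (1 <_)
    (trans (countFin≡sumFin q) (trans (sumFin-erase (fromBool ∘ q) k)
       (cong (λ b → fromBool b + sumFin (erase k (fromBool ∘ q))) qk)))
    count>1)
... | l , erased>0 with l Fin.≟ k
...   | yes refl = contradiction erased>0 (<-irrefl refl)
...   | no  l≢k with q l in ql
...     | true  = l , l≢k , ql
...     | false = contradiction erased>0 (<-irrefl refl)


countFin≡1⇔ : ∀ {n} (q : Fin n → Bool) {k} → q k ≡ true →
              countFin q ≡ 1 ⇔ (∀ i → i ≢ k → q i ≡ false)
countFin≡1⇔ q {k} qk = mk⇔
  (λ count≡1 i i≢k → Equivalence.to fromBool≡0⇔
     (Equivalence.to (sumFin≡term⇔ (fromBool ∘ q) k) (sumFin≡fk count≡1) i i≢k))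
  (λ others → trans (countFin≡sumFin q) (trans
     (Equivalence.from (sumFin≡term⇔ (fromBool ∘ q) k)
        (λ i i≢k → Equivalence.from fromBool≡0⇔ (others i i≢k)))
     fk≡1))
  where
  fk≡1 : fromBool (q k) ≡ 1
  fk≡1 = cong fromBool qk
  sumFin≡fk : countFin q ≡ 1 → sumFin (fromBool ∘ q) ≡ fromBool (q k)
  sumFin≡fk count≡1 = trans (sym (countFin≡sumFin q)) (trans count≡1 (sym fk≡1))

countFin≡2⇔ : ∀ {n} (q : Fin n → Bool) {k l} → l ≢ k → q k ≡ true → q l ≡ true →
              countFin q ≡ 2 ⇔ (∀ i → i ≢ k → i ≢ l → q i ≡ false)
countFin≡2⇔ q {k} {l} l≢k qk ql = mk⇔
  (λ count≡2 i i≢k i≢l → Equivalence.to fromBool≡0⇔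
     (Equivalence.to (sumFin≡two-terms⇔ (fromBool ∘ q) l≢k) (sumFin≡fk+fl count≡2) i i≢k i≢l))
  (λ others → trans (countFin≡sumFin q) (trans
     (Equivalence.from (sumFin≡two-terms⇔ (fromBool ∘ q) l≢k)
        (λ i i≢k i≢l → Equivalence.from fromBool≡0⇔ (others i i≢k i≢l)))
     fk+fl≡2))
  where
  fk+fl≡2 : fromBool (q k) + fromBool (q l) ≡ 2
  fk+fl≡2 = cong₂ (λ a b → fromBool a + fromBool b) qk ql
  sumFin≡fk+fl : countFin q ≡ 2 → sumFin (fromBool ∘ q) ≡ fromBool (q k) + fromBool (q l)
  sumFin≡fk+fl count≡2 = trans (sym (countFin≡sumFin q)) (trans count≡2 (sym fk+fl≡2))

j+countFin≡n⇔ : ∀ {n} (q : Fin n → Bool) j → j + countFin q ≡ n ⇔ countFin (not ∘ q) ≡ j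
j+countFin≡n⇔ {n} q j = mk⇔
  (λ j+c≡n → +-cancelˡ-≡ (countFin q) _ _
     (trans (countFin-complement q) (trans (sym j+c≡n) (+-comm j (countFin q)))))
  (λ c′≡j → trans (+-comm j (countFin q))
     (trans (cong (countFin q +_) (sym c′≡j)) (countFin-complement q)))

not≡false⇔ : ∀ {b} → not b ≡ false ⇔ b ≡ true
not≡false⇔ {true}  = mk⇔ (λ _ → refl) (λ _ → refl)
not≡false⇔ {false} = mk⇔ (λ ()) (λ ())

1+countFin≡n⇔ : ∀ {n} (q : Fin n → Bool) {k} → q k ≡ false →
                1 + countFin q ≡ n ⇔ (∀ i → i ≢ k → q i ≡ true)
1+countFin≡n⇔ q qk = mk⇔
  (λ eq i i≢k → Equivalence.to not≡false⇔
     (Equivalence.to (countFin≡1⇔ (not ∘ q) (cong not qk)) (Equivalence.to (j+countFin≡n⇔ q 1) eq) i i≢k))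
  (λ others → Equivalence.from (j+countFin≡n⇔ q 1)
     (Equivalence.from (countFin≡1⇔ (not ∘ q) (cong not qk))
        (λ i i≢k → Equivalence.from not≡false⇔ (others i i≢k))))

2+countFin≡n⇔ : ∀ {n} (q : Fin n → Bool) {k l} → l ≢ k → q k ≡ false → q l ≡ false →
                2 + countFin q ≡ n ⇔ (∀ i → i ≢ k → i ≢ l → q i ≡ true)
2+countFin≡n⇔ q l≢k qk ql = mk⇔
  (λ eq i i≢k i≢l → Equivalence.to not≡false⇔
     (Equivalence.to (countFin≡2⇔ (not ∘ q) l≢k (cong not qk) (cong not ql))
        (Equivalence.to (j+countFin≡n⇔ q 2) eq) i i≢k i≢l))
  (λ others → Equivalence.from (j+countFin≡n⇔ q 2)
     (Equivalence.from (countFin≡2⇔ (not ∘ q) l≢k (cong not qk) (cong not ql))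
        (λ i i≢k i≢l → Equivalence.from not≡false⇔ (others i i≢k i≢l))))

countFin>0 : ∀ {n} (q : Fin n → Bool) {k} → q k ≡ true → 0 < countFin q
countFin>0 q {k} qk = subst (0 <_)
  (sym (trans (countFin≡sumFin q) (trans (sumFin-erase (fromBool ∘ q) k)
     (cong (λ b → fromBool b + sumFin (erase k (fromBool ∘ q))) qk))))
  (s≤s z≤n)

countFin<n : ∀ {n} (q : Fin n → Bool) {k} → q k ≡ false → countFin q < n
countFin<n q qk = subst (countFin q <_) (countFin-complement q) (m<m+n (countFin q) (countFin>0 (not ∘ q) (cong not qk)))

countFin-cong : ∀ {n} {p q : Fin n → Bool} → (∀ i → p i ≡ q i) → countFin p ≡ countFin q
countFin-cong {zero}  p≗q = refl
countFin-cong {suc n} p≗q = cong₂ (λ b c → fromBool b + c) (p≗q fzero) (countFin-cong (p≗q ∘ fsuc))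

countFin-permute : ∀ {n} (q : Fin n → Bool) (π : Permutation′ n) → countFin q ≡ countFin (q ∘ (π ⟨$⟩ʳ_))
countFin-permute q π = begin
  countFin q                         ≡⟨ countFin≡sumFin q ⟩
  sumFin (fromBool ∘ q)              ≡⟨ sumFin-permute (fromBool ∘ q) π ⟩
  sumFin (fromBool ∘ q ∘ (π ⟨$⟩ʳ_))  ≡⟨ sym (countFin≡sumFin (q ∘ (π ⟨$⟩ʳ_))) ⟩
  countFin (q ∘ (π ⟨$⟩ʳ_))           ∎
  where open ≡-Reasoning

countFin-∨ : ∀ {n} (p q : Fin n → Bool) → (∀ i → p i ∧ q i ≡ false) →
             countFin (λ i → p i ∨ q i) ≡ countFin p + countFin q
countFin-∨ p q disjoint = begin
  countFin (λ i → p i ∨ q i)                       ≡⟨ countFin≡sumFin (λ i → p i ∨ q i) ⟩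
  sumFin (λ i → fromBool (p i ∨ q i))              ≡⟨ sumFin-cong (λ i → fromBool-∨ (p i) (q i) (disjoint i)) ⟩
  sumFin (λ i → fromBool (p i) + fromBool (q i))   ≡⟨ sumFin-+ (fromBool ∘ p) (fromBool ∘ q) ⟩
  sumFin (fromBool ∘ p) + sumFin (fromBool ∘ q)    ≡⟨ sym (cong₂ _+_ (countFin≡sumFin p) (countFin≡sumFin q)) ⟩
  countFin p + countFin q                          ∎
  where
  open ≡-Reasoning
  fromBool-∨ : ∀ a b → a ∧ b ≡ false → fromBool (a ∨ b) ≡ fromBool a + fromBool b
  fromBool-∨ true  false _ = refl
  fromBool-∨ false b     _ = refl

distinct : ∀ {m} → Fin m → Fin m → Bool
distinct a b = not (does (a Fin.≟ b))

distinct-sym : ∀ {m} (a b : Fin m) → distinct a b ≡ distinct b a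
distinct-sym a b with a Fin.≟ b
... | yes refl = cong not (sym (dec-true (a Fin.≟ a) refl))
... | no  a≢b  = cong not (sym (dec-false (b Fin.≟ a) (a≢b ∘ sym)))

countFin-erase : ∀ {n} (q : Fin n → Bool) {k} → q k ≡ true →
                 countFin q ≡ 1 + countFin (λ i → q i ∧ distinct k i)
countFin-erase q {k} qk = begin
  countFin q                                         ≡⟨ countFin≡sumFin q ⟩
  sumFin (fromBool ∘ q)                              ≡⟨ sumFin-erase (fromBool ∘ q) k ⟩
  fromBool (q k) + sumFin (erase k (fromBool ∘ q))   ≡⟨ cong₂ _+_ (cong fromBool qk) (sumFin-cong erased) ⟩
  1 + sumFin (λ i → fromBool (q i ∧ distinct k i))
                                                     ≡⟨ cong suc (sym (countFin≡sumFin (λ i → q i ∧ distinct k i))) ⟩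
  1 + countFin (λ i → q i ∧ distinct k i)  ∎
  where
  open ≡-Reasoning
  erased : ∀ i → erase k (fromBool ∘ q) i ≡ fromBool (q i ∧ distinct k i)
  erased i with i Fin.≟ k
  ... | yes refl rewrite dec-true (i Fin.≟ i) refl | ∧-zeroʳ (q i) = refl
  ... | no  i≢k  rewrite dec-false (k Fin.≟ i) (i≢k ∘ sym) | ∧-identityʳ (q i) = refl

countFin-none : ∀ {n} (q : Fin n → Bool) → (∀ i → q i ≡ false) → countFin q ≡ 0
countFin-none q none = trans (countFin≡sumFin q)
  (Equivalence.from sumFin≡0⇔ (λ i → Equivalence.from fromBool≡0⇔ (none i)))

countFin-toℕ< : ∀ {m k} → k ≤ m → countFin {m} (λ d → does (toℕ d <? k)) ≡ k
countFin-toℕ< {m}     {zero}  _         =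
  countFin-none {m} (λ d → does (toℕ d <? 0)) (λ d → dec-false (toℕ d <? 0) (λ ()))
countFin-toℕ< {suc m} {suc k} (s≤s k≤m) = cong suc (countFin-toℕ< k≤m)

countFin-toℕ≡ : ∀ {n c} → c < n → countFin {n} (λ b → does (toℕ b ≟ c)) ≡ 1
countFin-toℕ≡ {n} {c} c<n =
  Equivalence.from (countFin≡1⇔ (λ b → does (toℕ b ≟ c)) (dec-true (toℕ k ≟ c) (Fin.toℕ-fromℕ< c<n)))
    (λ b b≢k → dec-false (toℕ b ≟ c) (λ b≡c → b≢k (Fin.toℕ-injective
                                        (trans b≡c (sym (Fin.toℕ-fromℕ< c<n))))))
  where
  k : Fin n
  k = Fin.fromℕ< c<n

does≡true⇒ : ∀ {a} {A : Set a} (a? : Dec A) → does a? ≡ true → A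
does≡true⇒ (yes a) _ = a

data Parity : ℕ → Set where
  even : ∀ q → Parity (q * 2)
  odd  : ∀ q → Parity (suc (q * 2))

parity : ∀ n → Parity n
parity zero = even 0
parity (suc n) with parity n
... | even q = odd q
... | odd  q = even (suc q)

¬2∣odd : ∀ q → ¬ 2 ∣ suc (q * 2)
¬2∣odd q 2∣odd =
  contradiction (∣1⇒≡1 (∣m+n∣m⇒∣n (subst (2 ∣_) (+-comm 1 (q * 2)) 2∣odd) (divides q refl))) (λ ())

2∣n*[1+n] : ∀ n → 2 ∣ n * suc n
2∣n*[1+n] n with parity n
... | even q = ∣m⇒∣m*n (suc (q * 2)) (divides q refl)
... | odd  q = ∣n⇒∣m*n (suc (q * 2)) (divides (suc q) refl)

2∣n*n⇒2∣n : ∀ n → 2 ∣ n * n → 2 ∣ n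
2∣n*n⇒2∣n n 2∣n*n with euclidsLemma n n prime[2] 2∣n*n
... | inj₁ 2∣n = 2∣n
... | inj₂ 2∣n = 2∣n

¬2∣Δ[δ+1]⇒1<δ : ∀ {Δ δ} → 0 < δ → ¬ 2 ∣ Δ * suc δ → 1 < δ
¬2∣Δ[δ+1]⇒1<δ {Δ} {suc zero}    _ ¬2∣ = contradiction (n∣m*n Δ) ¬2∣
¬2∣Δ[δ+1]⇒1<δ {Δ} {suc (suc _)} _ _   = s≤s (s≤s z≤n)

h*2≡h+h : ∀ h → h * 2 ≡ h + h
h*2≡h+h = solve-∀

¬2∣odd*odd : ∀ p q → ¬ 2 ∣ suc (p * 2) * suc (q * 2)
¬2∣odd*odd p q 2∣ = [ ¬2∣odd p , ¬2∣odd q ] (euclidsLemma (suc (p * 2)) (suc (q * 2)) prime[2] 2∣)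

-- The handshake lemma

strictlyBefore : ∀ {n} → Fin n → Fin n → Bool
strictlyBefore i j = does (toℕ i <? toℕ j)

adj-split : (G : Graph) (i j : Fin (n G)) →
  fromBool (adj G i j) ≡ fromBool (strictlyBefore i j ∧ adj G i j) + fromBool (strictlyBefore j i ∧ adj G i j)
adj-split G i j with <-cmp (toℕ i) (toℕ j)
... | tri< i<j _ j≮i rewrite dec-true (toℕ i <? toℕ j) i<j | dec-false (toℕ j <? toℕ i) j≮i =
  sym (+-identityʳ _)
... | tri> i≮j _ j<i rewrite dec-false (toℕ i <? toℕ j) i≮j | dec-true (toℕ j <? toℕ i) j<i = refl
... | tri≈ _ i≡j _ rewrite Fin.toℕ-injective i≡j | irrefl G j | ∧-zeroʳ (strictlyBefore j j) = refl

handshake : (G : Graph) → 2 * edgeCount G ≡ sumFin (degree G)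
handshake G = begin
  2 * edgeCount G               ≡⟨ cong (edgeCount G +_) (+-identityʳ (edgeCount G)) ⟩
  edgeCount G + edgeCount G     ≡⟨ cong₂ _+_ (sumFin-cong (λ i → countFin≡sumFin (forward i)))
                                             (trans (sumFin-cong (λ j → countFin≡sumFin (forward j))) backward≡forward) ⟩
  sumFin (λ i → sumFin (F i)) + sumFin (λ i → sumFin (B i))
                                ≡⟨ sym (sumFin-+ (λ i → sumFin (F i)) (λ i → sumFin (B i))) ⟩
  sumFin (λ i → sumFin (F i) + sumFin (B i))
                                ≡⟨ sumFin-cong (λ i → sym (trans (countFin≡sumFin (adj G i))
                                     (trans (sumFin-cong (adj-split G i)) (sumFin-+ (F i) (B i))))) ⟩
  sumFin (degree G)             ∎
  where
  open ≡-Reasoning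
  forward : Fin (n G) → Fin (n G) → Bool
  forward i j = strictlyBefore i j ∧ adj G i j
  F B : Fin (n G) → Fin (n G) → ℕ
  F i j = fromBool (forward i j)
  B i j = fromBool (strictlyBefore j i ∧ adj G i j)
  backward≡forward : sumFin (λ j → sumFin (F j)) ≡ sumFin (λ i → sumFin (B i))
  backward≡forward = trans (sumFin-comm F)
    (sumFin-cong (λ i → sumFin-cong (λ j → cong (λ b → fromBool (strictlyBefore j i ∧ b)) (Graph.sym G j i))))

-- The degree sum of a graph with minimum degree δ and a vertex of degree Δ

module DegreeSum (G : Graph) {δ Δ : ℕ} (δ≤degree : ∀ i → δ ≤ degree G i)
              (v : Fin (n G)) (degree-v : degree G v ≡ Δ) where

  Δ<order : Δ < n G
  Δ<order = subst (_< n G) degree-v (countFin<n (adj G v) (irrefl G v))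

  surplus : Fin (n G) → ℕ
  surplus i = degree G i ∸ δ

  surplus≡⇔ : ∀ {i c} → surplus i ≡ c ⇔ degree G i ≡ δ + c
  surplus≡⇔ {i} = mk⇔
    (λ s≡c → trans (sym (m+[n∸m]≡n (δ≤degree i))) (cong (δ +_) s≡c))
    (λ d≡δ+c → +-cancelˡ-≡ δ _ _ (trans (m+[n∸m]≡n (δ≤degree i)) d≡δ+c))

  extraVertices : ℕ
  extraVertices = n G ∸ suc Δ

  excess : ℕ
  excess = sumFin (erase v surplus)

  slack : ℕ
  slack = extraVertices * δ + excess

  degreeSum≡ : sumFin (degree G) ≡ Δ * suc δ + slack
  degreeSum≡ = begin
    sumFin (degree G)                                  ≡⟨ sumFin-cong (λ i → sym (m+[n∸m]≡n (δ≤degree i))) ⟩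
    sumFin (λ i → δ + surplus i)                       ≡⟨ sumFin-+ (λ _ → δ) surplus ⟩
    sumFin {n G} (λ _ → δ) + sumFin surplus            ≡⟨ cong₂ _+_ (sumFin-const (n G) δ) (sumFin-erase surplus v) ⟩
    n G * δ + (surplus v + excess)                     ≡⟨ cong₂ (λ N s → N * δ + (s + excess))
                                                            (sym (m+[n∸m]≡n Δ<order)) (cong (_∸ δ) degree-v) ⟩
    (suc Δ + t) * δ + ((Δ ∸ δ) + excess)               ≡⟨ regroup Δ δ t (Δ ∸ δ) excess ⟩
    Δ * δ + (δ + (Δ ∸ δ)) + (t * δ + excess)           ≡⟨ cong (λ x → Δ * δ + x + (t * δ + excess)) (m+[n∸m]≡n δ≤Δ) ⟩
    Δ * δ + Δ + (t * δ + excess)                       ≡⟨ cong (_+ (t * δ + excess)) (+-comm (Δ * δ) Δ) ⟩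
    Δ + Δ * δ + (t * δ + excess)                       ≡⟨ cong (_+ (t * δ + excess)) (sym (*-suc Δ δ)) ⟩
    Δ * suc δ + (t * δ + excess)                       ∎
    where
    open ≡-Reasoning
    t : ℕ
    t = extraVertices
    δ≤Δ : δ ≤ Δ
    δ≤Δ = subst (δ ≤_) degree-v (δ≤degree v)
    regroup : ∀ Δ δ t e r → (suc Δ + t) * δ + (e + r) ≡ Δ * δ + (δ + e) + (t * δ + r)
    regroup = solve-∀

  2|E|≡ : 2 * edgeCount G ≡ Δ * suc δ + slack
  2|E|≡ = trans (handshake G) degreeSum≡

  Δ[δ+1]≤2|E| : Δ * suc δ ≤ 2 * edgeCount G
  Δ[δ+1]≤2|E| = subst (Δ * suc δ ≤_) (sym 2|E|≡) (m≤m+n (Δ * suc δ) slack)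

  2|E|≡⇔slack≡ : ∀ c → 2 * edgeCount G ≡ c + Δ * suc δ ⇔ slack ≡ c
  2|E|≡⇔slack≡ c = mk⇔
    (λ 2|E|≡c+ → +-cancelˡ-≡ (Δ * suc δ) _ _ (trans (sym 2|E|≡) (trans 2|E|≡c+ (+-comm c (Δ * suc δ)))))
    (λ slack≡c → trans 2|E|≡ (trans (cong (Δ * suc δ +_) slack≡c) (+-comm (Δ * suc δ) c)))

  OthersMinimal : Set
  OthersMinimal = ∀ i → i ≢ v → degree G i ≡ δ

  OneOtherAboveMinimal : Set
  OneOtherAboveMinimal =
    ∃[ w ] w ≢ v × degree G w ≡ suc δ × (∀ i → i ≢ v → i ≢ w → degree G i ≡ δ)

  EvenExtremal OddExtremal : Set
  EvenExtremal = n G ≡ suc Δ × OthersMinimal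
  OddExtremal  = n G ≡ suc Δ × OneOtherAboveMinimal

  extraVertices≡0⇔ : extraVertices ≡ 0 ⇔ n G ≡ suc Δ
  extraVertices≡0⇔ = mk⇔
    (λ t≡0 → trans (sym (m+[n∸m]≡n Δ<order)) (trans (cong (suc Δ +_) t≡0) (+-identityʳ (suc Δ))))
    (λ N≡ → trans (cong (_∸ suc Δ) N≡) (n∸n≡0 (suc Δ)))

  surplus≡0⇒ : ∀ {i} → surplus i ≡ 0 → degree G i ≡ δ
  surplus≡0⇒ s≡0 = trans (Equivalence.to surplus≡⇔ s≡0) (+-identityʳ δ)

  ⇒surplus≡0 : ∀ {i} → degree G i ≡ δ → surplus i ≡ 0
  ⇒surplus≡0 d≡δ = Equivalence.from surplus≡⇔ (trans d≡δ (sym (+-identityʳ δ)))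

  excess≡0⇔ : excess ≡ 0 ⇔ OthersMinimal
  excess≡0⇔ = mk⇔
    (λ e≡0 i i≢v → surplus≡0⇒ (Equivalence.to (sumFin-erase≡0⇔ surplus v) e≡0 i i≢v))
    (λ minimal → Equivalence.from (sumFin-erase≡0⇔ surplus v) (λ i i≢v → ⇒surplus≡0 (minimal i i≢v)))

  excess≡1⇔ : excess ≡ 1 ⇔ OneOtherAboveMinimal
  excess≡1⇔ = mk⇔ to from
    where
    to : excess ≡ 1 → OneOtherAboveMinimal
    to e≡1 with sumFin≡1⇒ (erase v surplus) e≡1
    ... | w , erased≡1 , rest with w Fin.≟ v
    ...   | yes refl = contradiction erased≡1 (λ ())
    ...   | no w≢v = w , w≢v
                   , trans (Equivalence.to surplus≡⇔ erased≡1) (+-comm δ 1)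
                   , λ i i≢v i≢w → surplus≡0⇒ (trans (sym (erase-other surplus i≢v)) (rest i i≢w))
    from : OneOtherAboveMinimal → excess ≡ 1
    from (w , w≢v , degree-w , others) = begin
      excess                ≡⟨ Equivalence.from (sumFin≡term⇔ (erase v surplus) w) zeroElsewhere ⟩
      erase v surplus w     ≡⟨ erase-other surplus w≢v ⟩
      surplus w             ≡⟨ Equivalence.from surplus≡⇔ (trans degree-w (+-comm 1 δ)) ⟩
      1                     ∎
      where
      open ≡-Reasoning
      zeroElsewhere : ∀ i → i ≢ w → erase v surplus i ≡ 0
      zeroElsewhere i i≢w with i Fin.≟ v
      ... | yes _   = refl
      ... | no  i≢v = ⇒surplus≡0 (others i i≢v i≢w)

  slack≡0⇔ : 0 < δ → slack ≡ 0 ⇔ EvenExtremal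
  slack≡0⇔ δ>0 = mk⇔
    (λ s≡0 → Equivalence.to extraVertices≡0⇔ (t≡0 (m+n≡0⇒m≡0 (extraVertices * δ) s≡0))
           , Equivalence.to excess≡0⇔ (m+n≡0⇒n≡0 (extraVertices * δ) s≡0))
    (λ (N≡ , minimal) → cong₂ (λ t e → t * δ + e)
        (Equivalence.from extraVertices≡0⇔ N≡) (Equivalence.from excess≡0⇔ minimal))
    where
    t≡0 : extraVertices * δ ≡ 0 → extraVertices ≡ 0
    t≡0 tδ≡0 with m*n≡0⇒m≡0∨n≡0 extraVertices tδ≡0
    ... | inj₁ t≡0 = t≡0
    ... | inj₂ refl = contradiction δ>0 (<-irrefl refl)

  slack≡1⇔ : 1 < δ → slack ≡ 1 ⇔ OddExtremal
  slack≡1⇔ δ>1 = mk⇔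
    (λ s≡1 → Equivalence.to extraVertices≡0⇔ (t≡0 s≡1) , Equivalence.to excess≡1⇔ (e≡1 s≡1))
    (λ (N≡ , oneAbove) → cong₂ (λ t e → t * δ + e)
        (Equivalence.from extraVertices≡0⇔ N≡) (Equivalence.from excess≡1⇔ oneAbove))
    where
    t≡0 : slack ≡ 1 → extraVertices ≡ 0
    t≡0 s≡1 with extraVertices
    ... | zero    = refl
    ... | suc t′ = contradiction (subst (δ ≤_) s≡1 (≤-trans (m≤m+n δ (t′ * δ)) (m≤m+n _ excess)))
                                 (<⇒≱ δ>1)
    e≡1 : slack ≡ 1 → excess ≡ 1
    e≡1 s≡1 = trans (sym (cong (λ t → t * δ + excess) (t≡0 s≡1))) s≡1

to-injective : ∀ {m k} (f : Permutation m k) {i j} → Inverse.to f i ≡ Inverse.to f j → i ≡ j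
to-injective f = Injection.injective (↔⇒↣ f)

isoComplete⇒1+degree≡order : ∀ G {m} → IsoComplete G m → ∀ i → 1 + degree G i ≡ n G
isoComplete⇒1+degree≡order G (f , adj≡) i = Equivalence.from (1+countFin≡n⇔ (adj G i) (irrefl G i))
  (λ j j≢i → trans (adj≡ i j) (cong not (dec-false (Inverse.to f i Fin.≟ Inverse.to f j)
                                          (j≢i ∘ sym ∘ to-injective f))))

regular⇒isoComplete : ∀ G {d} → n G ≡ suc d → (∀ i → degree G i ≡ d) → IsoComplete G (suc d)
regular⇒isoComplete G {d} N≡ regular = cast-id N≡ , adj≡
  where
  adjacentToOthers : ∀ i j → j ≢ i → adj G i j ≡ true
  adjacentToOthers i = Equivalence.to (1+countFin≡n⇔ (adj G i) (irrefl G i)) (trans (cong suc (regular i)) (sym N≡))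
  adj≡ : ∀ i j → adj G i j ≡ completeAdj (suc d) (Fin.cast N≡ i) (Fin.cast N≡ j)
  adj≡ i j with i Fin.≟ j
  ... | yes refl = trans (irrefl G i) (cong not (sym (dec-true (Fin.cast N≡ i Fin.≟ Fin.cast N≡ i) refl)))
  ... | no  i≢j  = trans (adjacentToOthers i j (i≢j ∘ sym)) (cong not (sym
                     (dec-false (Fin.cast N≡ i Fin.≟ Fin.cast N≡ j) (i≢j ∘ to-injective (cast-id N≡)))))

-- Membership in 𝒢 δ Δ

module Classification {δ Δ : ℕ} (G : Graph) (mn : MinDegree G δ) (mx : MaxDegree G Δ) where

  v : Fin (n G)
  v = proj₁ (proj₂ mx)

  degree-v : degree G v ≡ Δ
  degree-v = proj₂ (proj₂ mx)

  open DegreeSum G (proj₁ mn) v degree-v public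

  δ≤Δ : δ ≤ Δ
  δ≤Δ = subst (δ ≤_) degree-v (proj₁ mn v)

  hasDegree : ℕ → Fin (n G) → Bool
  hasDegree d i = does (degree G i ≟ d)

  hasDegree-≢ : ∀ {d i} → degree G i ≢ d → hasDegree d i ≡ false
  hasDegree-≢ {d} {i} = dec-false (degree G i ≟ d)

  hasDegree-≡ : ∀ {d i} → degree G i ≡ d → hasDegree d i ≡ true
  hasDegree-≡ {d} {i} = dec-true (degree G i ≟ d)

  hasDegree⇒ : ∀ {d i} → hasDegree d i ≡ true → degree G i ≡ d
  hasDegree⇒ {d} {i} = does≡true⇒ (degree G i ≟ d)

  v-notMinimal : δ < Δ → hasDegree δ v ≡ false
  v-notMinimal δ<Δ = hasDegree-≢ (λ Δ≡δ → <⇒≢ δ<Δ (trans (sym Δ≡δ) degree-v))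

  numDeg≡Δ⇔ : δ < Δ → n G ≡ suc Δ → numDeg G δ ≡ Δ ⇔ OthersMinimal
  numDeg≡Δ⇔ δ<Δ order≡ = mk⇔
    (λ numDeg≡ i i≢v → hasDegree⇒ (Equivalence.to count⇔ (trans (cong suc numDeg≡) (sym order≡)) i i≢v))
    (λ minimal → suc-injective (trans (Equivalence.from count⇔ (λ i i≢v → hasDegree-≡ (minimal i i≢v))) order≡))
    where
    count⇔ : 1 + numDeg G δ ≡ n G ⇔ (∀ i → i ≢ v → hasDegree δ i ≡ true)
    count⇔ = 1+countFin≡n⇔ (hasDegree δ) (v-notMinimal δ<Δ)

  numDeg≡Δ∸1⇔ : δ < Δ → n G ≡ suc Δ → ∀ {w} → w ≢ v → degree G w ≡ suc δ →
                numDeg G δ ≡ Δ ∸ 1 ⇔ (∀ i → i ≢ v → i ≢ w → degree G i ≡ δ)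
  numDeg≡Δ∸1⇔ δ<Δ order≡ {w} w≢v degree-w = mk⇔
    (λ numDeg≡ i i≢v i≢w → hasDegree⇒ (Equivalence.to count⇔ (trans (cong (2 +_) numDeg≡) 1+Δ≡order) i i≢v i≢w))
    (λ minimal → cong (_∸ 1) (suc-injective (trans
       (Equivalence.from count⇔ (λ i i≢v i≢w → hasDegree-≡ (minimal i i≢v i≢w))) order≡)))
    where
    count⇔ : 2 + numDeg G δ ≡ n G ⇔ (∀ i → i ≢ v → i ≢ w → hasDegree δ i ≡ true)
    count⇔ = 2+countFin≡n⇔ (hasDegree δ) w≢v (v-notMinimal δ<Δ)
               (hasDegree-≢ (λ degree-w≡δ → 1+n≢n (trans (sym degree-w) degree-w≡δ)))
    1+Δ≡order : suc (suc (Δ ∸ 1)) ≡ n G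
    1+Δ≡order = trans (cong suc (m+[n∸m]≡n (≤-trans (s≤s z≤n) δ<Δ))) (sym order≡)

  module _ (2∣Δ[δ+1] : 2 ∣ Δ * suc δ) where

    inClass⇒evenExtremal : InClass δ Δ G → EvenExtremal
    inClass⇒evenExtremal (_ , _ , inj₁ (δ≡Δ , iso)) =
      order≡ , λ i _ → trans (suc-injective (trans (isoComplete⇒1+degree≡order G iso i) order≡)) (sym δ≡Δ)
      where
      order≡ : n G ≡ suc Δ
      order≡ = trans (sym (isoComplete⇒1+degree≡order G iso v)) (cong suc degree-v)
    inClass⇒evenExtremal (_ , _ , inj₂ (inj₁ (δ<Δ , _ , order≡ , numDeg≡Δ))) =
      order≡ , Equivalence.to (numDeg≡Δ⇔ δ<Δ order≡) numDeg≡Δ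
    inClass⇒evenExtremal (_ , _ , inj₂ (inj₂ (inj₁ (_ , ¬2∣Δ[δ+1] , _)))) = contradiction 2∣Δ[δ+1] ¬2∣Δ[δ+1]
    inClass⇒evenExtremal (_ , _ , inj₂ (inj₂ (inj₂ (δ+1≡Δ , ¬2∣Δ , _)))) =
      contradiction (2∣n*n⇒2∣n Δ (subst (λ x → 2 ∣ Δ * x) δ+1≡Δ 2∣Δ[δ+1])) ¬2∣Δ

    evenExtremal⇒inClass : EvenExtremal → InClass δ Δ G
    evenExtremal⇒inClass (order≡ , minimal) with δ ≟ Δ
    ... | yes δ≡Δ = mn , mx , inj₁ (δ≡Δ , regular⇒isoComplete G order≡ regular)
      where
      regular : ∀ i → degree G i ≡ Δ
      regular i with i Fin.≟ v
      ... | yes refl = degree-v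
      ... | no  i≢v  = trans (minimal i i≢v) δ≡Δ
    ... | no  δ≢Δ =
      mn , mx , inj₂ (inj₁ (δ<Δ , 2∣Δ[δ+1] , order≡ , Equivalence.from (numDeg≡Δ⇔ δ<Δ order≡) minimal))
      where
      δ<Δ : δ < Δ
      δ<Δ = ≤∧≢⇒< δ≤Δ δ≢Δ

    inClass⇔evenExtremal : InClass δ Δ G ⇔ EvenExtremal
    inClass⇔evenExtremal = mk⇔ inClass⇒evenExtremal evenExtremal⇒inClass

    2|E|≡Δ[δ+1]⇔inClass : 0 < δ → 2 * edgeCount G ≡ Δ * suc δ ⇔ InClass δ Δ G
    2|E|≡Δ[δ+1]⇔inClass 0<δ =
      ⇔-trans (2|E|≡⇔slack≡ 0) (⇔-trans (slack≡0⇔ 0<δ) (⇔-sym inClass⇔evenExtremal))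

  module _ (¬2∣Δ[δ+1] : ¬ 2 ∣ Δ * suc δ) where

    δ<Δ : δ < Δ
    δ<Δ = ≤∧≢⇒< δ≤Δ (λ δ≡Δ → ¬2∣Δ[δ+1] (subst (λ x → 2 ∣ x * suc δ) δ≡Δ (2∣n*[1+n] δ)))

    inClass⇒oddExtremal : InClass δ Δ G → OddExtremal
    inClass⇒oddExtremal (_ , _ , inj₁ (δ≡Δ , _)) = contradiction δ≡Δ (<⇒≢ δ<Δ)
    inClass⇒oddExtremal (_ , _ , inj₂ (inj₁ (_ , 2∣Δ[δ+1] , _))) = contradiction 2∣Δ[δ+1] ¬2∣Δ[δ+1]
    inClass⇒oddExtremal (_ , _ , inj₂ (inj₂ (inj₁ (δ+1<Δ , _ , order≡ , numDeg≡ , numDeg[δ+1]≡1))))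
      with countFin>0⇒ (hasDegree (suc δ)) (subst (0 <_) (sym numDeg[δ+1]≡1) (s≤s z≤n))
    ... | w , w-above =
      order≡ , w , w≢v , degree-w , Equivalence.to (numDeg≡Δ∸1⇔ δ<Δ order≡ w≢v degree-w) numDeg≡
      where
      degree-w : degree G w ≡ suc δ
      degree-w = hasDegree⇒ w-above
      w≢v : w ≢ v
      w≢v refl = <⇒≢ δ+1<Δ (trans (sym degree-w) degree-v)
    inClass⇒oddExtremal (_ , _ , inj₂ (inj₂ (inj₂ (δ+1≡Δ , _ , order≡ , numDeg≡ , numDegΔ≡2))))
      with countFin-another (hasDegree Δ) (hasDegree-≡ degree-v) (subst (1 <_) (sym numDegΔ≡2) ≤-refl)
    ... | w , w≢v , w-maximal =
      order≡ , w , w≢v , degree-w , Equivalence.to (numDeg≡Δ∸1⇔ δ<Δ order≡ w≢v degree-w) numDeg≡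
      where
      degree-w : degree G w ≡ suc δ
      degree-w = trans (hasDegree⇒ w-maximal) (sym δ+1≡Δ)

    oddExtremal⇒inClass : OddExtremal → InClass δ Δ G
    oddExtremal⇒inClass (order≡ , w , w≢v , degree-w , minimal) with suc δ ≟ Δ
    ... | yes δ+1≡Δ = mn , mx , inj₂ (inj₂ (inj₂ (δ+1≡Δ , ¬2∣Δ , order≡ , numDeg≡ ,
        Equivalence.from
          (countFin≡2⇔ (hasDegree Δ) w≢v (hasDegree-≡ degree-v) (hasDegree-≡ (trans degree-w δ+1≡Δ)))
          (λ i i≢v i≢w → hasDegree-≢ (λ degree-i≡Δ → <⇒≢ δ<Δ (trans (sym (minimal i i≢v i≢w)) degree-i≡Δ))))))
      where
      ¬2∣Δ : ¬ 2 ∣ Δ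
      ¬2∣Δ 2∣Δ = ¬2∣Δ[δ+1] (∣m⇒∣m*n (suc δ) 2∣Δ)
      numDeg≡ : numDeg G δ ≡ Δ ∸ 1
      numDeg≡ = Equivalence.from (numDeg≡Δ∸1⇔ δ<Δ order≡ w≢v degree-w) minimal
    ... | no δ+1≢Δ = mn , mx , inj₂ (inj₂ (inj₁ (≤∧≢⇒< δ<Δ δ+1≢Δ , ¬2∣Δ[δ+1] , order≡ , numDeg≡ ,
        Equivalence.from (countFin≡1⇔ (hasDegree (suc δ)) (hasDegree-≡ degree-w)) onlyW)))
      where
      numDeg≡ : numDeg G δ ≡ Δ ∸ 1
      numDeg≡ = Equivalence.from (numDeg≡Δ∸1⇔ δ<Δ order≡ w≢v degree-w) minimal
      onlyW : ∀ i → i ≢ w → hasDegree (suc δ) i ≡ false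
      onlyW i i≢w with i Fin.≟ v
      ... | yes refl = hasDegree-≢ (λ Δ≡δ+1 → δ+1≢Δ (trans (sym Δ≡δ+1) degree-v))
      ... | no  i≢v  = hasDegree-≢ (λ degree-i≡δ+1 → 1+n≢n (trans (sym degree-i≡δ+1) (minimal i i≢v i≢w)))

    inClass⇔oddExtremal : InClass δ Δ G ⇔ OddExtremal
    inClass⇔oddExtremal = mk⇔ inClass⇒oddExtremal oddExtremal⇒inClass

    1+Δ[δ+1]≤2|E| : suc (Δ * suc δ) ≤ 2 * edgeCount G
    1+Δ[δ+1]≤2|E| = ≤∧≢⇒< Δ[δ+1]≤2|E|
      (λ Δ[δ+1]≡2|E| → ¬2∣Δ[δ+1] (subst (2 ∣_) (sym Δ[δ+1]≡2|E|) (m∣m*n (edgeCount G))))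

    2|E|≡1+Δ[δ+1]⇔inClass : 0 < δ → 2 * edgeCount G ≡ suc (Δ * suc δ) ⇔ InClass δ Δ G
    2|E|≡1+Δ[δ+1]⇔inClass 0<δ =
      ⇔-trans (2|E|≡⇔slack≡ 1)
        (⇔-trans (slack≡1⇔ (¬2∣Δ[δ+1]⇒1<δ {Δ} 0<δ ¬2∣Δ[δ+1])) (⇔-sym inClass⇔oddExtremal))

-- Adding an apex to a graph

record SimpleGraph (m : ℕ) : Set where
  field
    edge        : Fin m → Fin m → Bool
    edge-sym    : ∀ a b → edge a b ≡ edge b a
    edge-irrefl : ∀ a → edge a a ≡ false

open SimpleGraph

deg : ∀ {m} → SimpleGraph m → Fin m → ℕ
deg X a = countFin (edge X a)

complement : ∀ {m} → SimpleGraph m → SimpleGraph m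
complement X = record
  { edge        = λ a b → not (edge X a b) ∧ distinct a b
  ; edge-sym    = λ a b → cong₂ (λ e d → not e ∧ d) (edge-sym X a b) (distinct-sym a b)
  ; edge-irrefl = λ a → trans (cong (λ d → not (edge X a a) ∧ not d) (dec-true (a Fin.≟ a) refl))
                              (∧-zeroʳ (not (edge X a a)))
  }

1+deg+deg-complement : ∀ {m} (X : SimpleGraph m) a → 1 + (deg X a + deg (complement X) a) ≡ m
1+deg+deg-complement {m} X a = begin
  1 + (deg X a + deg (complement X) a)   ≡⟨ x∙yz≈y∙xz 1 (deg X a) _ ⟩
  deg X a + (1 + deg (complement X) a)   ≡⟨ cong (deg X a +_) (sym (countFin-erase (not ∘ edge X a) nonLoop)) ⟩
  deg X a + countFin (not ∘ edge X a)    ≡⟨ countFin-complement (edge X a) ⟩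
  m                                      ∎
  where
  open ≡-Reasoning
  nonLoop : not (edge X a a) ≡ true
  nonLoop = cong not (edge-irrefl X a)

_∪_ : ∀ {m} → SimpleGraph m → SimpleGraph m → SimpleGraph m
X ∪ Y = record
  { edge        = λ a b → edge X a b ∨ edge Y a b
  ; edge-sym    = λ a b → cong₂ _∨_ (edge-sym X a b) (edge-sym Y a b)
  ; edge-irrefl = λ a → cong₂ _∨_ (edge-irrefl X a) (edge-irrefl Y a)
  }

deg-∪ : ∀ {m} (X Y : SimpleGraph m) a → (∀ b → edge X a b ∧ edge Y a b ≡ false) →
        deg (X ∪ Y) a ≡ deg X a + deg Y a
deg-∪ X Y a disjoint = countFin-∨ (edge X a) (edge Y a) disjoint

coneEdge : ∀ {m} → (Fin m → Fin m → Bool) → Fin (suc m) → Fin (suc m) → Bool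
coneEdge e fzero    fzero    = false
coneEdge e fzero    (fsuc _) = true
coneEdge e (fsuc _) fzero    = true
coneEdge e (fsuc a) (fsuc b) = e a b

cone : ∀ {m} → SimpleGraph (suc m) → Graph
cone {m} X = record
  { n       = suc (suc m)
  ; adj     = coneEdge (edge X)
  ; sym     = coneEdge-sym
  ; irrefl  = λ { fzero → refl ; (fsuc a) → edge-irrefl X a }
  ; hasEdge = fzero , fsuc fzero , refl
  }
  where
  coneEdge-sym : ∀ a b → coneEdge (edge X) a b ≡ coneEdge (edge X) b a
  coneEdge-sym fzero    fzero    = refl
  coneEdge-sym fzero    (fsuc _) = refl
  coneEdge-sym (fsuc _) fzero    = refl
  coneEdge-sym (fsuc a) (fsuc b) = edge-sym X a b

degree-apex : ∀ {m} (X : SimpleGraph (suc m)) → degree (cone X) fzero ≡ suc m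
degree-apex {m} X = countFin-all (suc m)
  where
  countFin-all : ∀ n → countFin {n} (λ _ → true) ≡ n
  countFin-all zero    = refl
  countFin-all (suc n) = cong suc (countFin-all n)

deg-complement≡ : ∀ {m} (X : SimpleGraph m) a {s t} → deg X a ≡ s → m ≡ suc (s + t) → deg (complement X) a ≡ t
deg-complement≡ {m} X a {s} {t} deg≡s m≡ =
  +-cancelˡ-≡ s _ _ (suc-injective (trans (trans (cong (λ d → suc (d + deg (complement X) a)) (sym deg≡s))
                                                 (1+deg+deg-complement X a)) m≡))

module _ {m : ℕ} (X : SimpleGraph (suc m)) where

  degree-cone≤ : ∀ i → degree (cone X) i ≤ suc m
  degree-cone≤ fzero    = ≤-reflexive (degree-apex X)
  degree-cone≤ (fsuc a) = countFin<n (edge X a) (edge-irrefl X a)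

  maxDegree-cone : MaxDegree (cone X) (suc m)
  maxDegree-cone = degree-cone≤ , fzero , degree-apex X

  cone-evenClass : ∀ {δ} → δ ≤ suc m → 2 ∣ suc m * suc δ → (∀ a → suc (deg X a) ≡ δ) →
                   InClass δ (suc m) (cone X)
  cone-evenClass {δ} δ≤Δ 2∣Δ[δ+1] regular =
    Equivalence.from (inClass⇔evenExtremal 2∣Δ[δ+1]) (refl , othersMinimal)
    where
    δ≤degree : ∀ i → δ ≤ degree (cone X) i
    δ≤degree fzero    = subst (δ ≤_) (sym (degree-apex X)) δ≤Δ
    δ≤degree (fsuc a) = ≤-reflexive (sym (regular a))
    minDegree : MinDegree (cone X) δ
    minDegree = δ≤degree , fsuc fzero , regular fzero
    open Classification (cone X) minDegree maxDegree-cone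
    othersMinimal : OthersMinimal
    othersMinimal fzero    0≢0 = contradiction refl 0≢0
    othersMinimal (fsuc a) _   = regular a

module _ {m : ℕ} (X : SimpleGraph (suc (suc m))) where

  cone-oddClass : ∀ {δ} → ¬ 2 ∣ suc (suc m) * suc δ →
                  deg X fzero ≡ δ → (∀ a → suc (deg X (fsuc a)) ≡ δ) → InClass δ (suc (suc m)) (cone X)
  cone-oddClass {δ} ¬2∣Δ[δ+1] deg₀ nearRegular =
    Equivalence.from (inClass⇔oddExtremal ¬2∣Δ[δ+1])
      (refl , fsuc fzero , (λ ()) , cong suc deg₀ , othersMinimal)
    where
    δ≤degree : ∀ i → δ ≤ degree (cone X) i
    δ≤degree fzero           = subst (δ ≤_) (sym (degree-apex X)) (≤-trans (n≤1+n δ)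
                                 (subst (_≤ suc (suc m)) (cong suc deg₀) (degree-cone≤ X (fsuc fzero))))
    δ≤degree (fsuc fzero)    = subst (δ ≤_) (cong suc (sym deg₀)) (n≤1+n δ)
    δ≤degree (fsuc (fsuc a)) = ≤-reflexive (sym (nearRegular a))
    minDegree : MinDegree (cone X) δ
    minDegree = δ≤degree , fsuc (fsuc fzero) , nearRegular fzero
    open Classification (cone X) minDegree (maxDegree-cone X)
    othersMinimal : ∀ i → i ≢ fzero → i ≢ fsuc fzero → degree (cone X) i ≡ δ
    othersMinimal fzero           0≢0 _   = contradiction refl 0≢0
    othersMinimal (fsuc fzero)    _   1≢1 = contradiction refl 1≢1
    othersMinimal (fsuc (fsuc a)) _   _   = nearRegular a

-- Circulant graphs

inArc : ℕ → ℕ → Bool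
inArc k d = does (0 <? d ×-dec d <? suc k)

inArc⇒ : ∀ {k d} → inArc k d ≡ true → 0 < d × d ≤ k
inArc⇒ {k} {d} arc with does≡true⇒ (0 <? d ×-dec d <? suc k) arc
... | 0<d , d<1+k = 0<d , s≤s⁻¹ d<1+k

-- inArc k 0 is false and inArc k (suc d) computes to does (d <? k).
countFin-inArc : ∀ {m k} → k < m → countFin {m} (inArc k ∘ toℕ) ≡ k
countFin-inArc {suc m} (s≤s k≤m) = countFin-toℕ< k≤m

inArc-beyond : ∀ {k d} → k < d → inArc k d ≡ false
inArc-beyond {k} {d} k<d = dec-false (0 <? d ×-dec d <? suc k) (λ (_ , d<1+k) → <⇒≱ k<d (s≤s⁻¹ d<1+k))

module _ {m : ℕ} .{{_ : NonZero m}} where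

  rotate : ℕ → Fin m → Fin m
  rotate s b = (toℕ b + s) mod m

  toℕ-rotate : ∀ s b → toℕ (rotate s b) ≡ (toℕ b + s) % m
  toℕ-rotate s b = Fin.toℕ-fromℕ< (m%n<n (toℕ b + s) m)

  [x%m+y]%m≡[x+y]%m : ∀ x y → (x % m + y) % m ≡ (x + y) % m
  [x%m+y]%m≡[x+y]%m x y = begin
    (x % m + y) % m            ≡⟨ %-distribˡ-+ (x % m) y m ⟩
    (x % m % m + y % m) % m    ≡⟨ cong (λ z → (z + y % m) % m) (m%n%n≡m%n x m) ⟩
    (x % m + y % m) % m        ≡⟨ sym (%-distribˡ-+ x y m) ⟩
    (x + y) % m                ∎
    where open ≡-Reasoning

  rotate-rotate : ∀ {s t} → s + t ≡ m → ∀ b → rotate t (rotate s b) ≡ b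
  rotate-rotate {s} {t} s+t≡m b = Fin.toℕ-injective (begin
    toℕ (rotate t (rotate s b))   ≡⟨ toℕ-rotate t (rotate s b) ⟩
    (toℕ (rotate s b) + t) % m    ≡⟨ cong (λ z → (z + t) % m) (toℕ-rotate s b) ⟩
    ((toℕ b + s) % m + t) % m     ≡⟨ [x%m+y]%m≡[x+y]%m (toℕ b + s) t ⟩
    (toℕ b + s + t) % m           ≡⟨ cong (_% m) (trans (+-assoc (toℕ b) s t) (cong (toℕ b +_) s+t≡m)) ⟩
    (toℕ b + m) % m               ≡⟨ [m+n]%n≡m%n (toℕ b) m ⟩
    toℕ b % m                     ≡⟨ m<n⇒m%n≡m (Fin.toℕ<n b) ⟩
    toℕ b                         ∎)
    where open ≡-Reasoning

  rotation : ∀ {s} → s ≤ m → Permutation′ m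
  rotation {s} s≤m = permutation (rotate s) (rotate (m ∸ s))
    (rotate-rotate (m∸n+n≡m s≤m)) (rotate-rotate (m+[n∸m]≡n s≤m))

  offset : Fin m → Fin m → ℕ
  offset a b = toℕ (rotate (m ∸ toℕ a) b)

  offset-self : ∀ a → offset a a ≡ 0
  offset-self a = begin
    toℕ (rotate (m ∸ toℕ a) a)   ≡⟨ toℕ-rotate (m ∸ toℕ a) a ⟩
    (toℕ a + (m ∸ toℕ a)) % m    ≡⟨ cong (_% m) (m+[n∸m]≡n (<⇒≤ (Fin.toℕ<n a))) ⟩
    m % m                        ≡⟨ n%n≡0 m ⟩
    0                            ∎
    where open ≡-Reasoning

  offset+offset%m≡0 : ∀ a b → (offset a b + offset b a) % m ≡ 0
  offset+offset%m≡0 a b = begin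
    (offset a b + offset b a) % m
      ≡⟨ cong₂ (λ x y → (x + y) % m) (toℕ-rotate (m ∸ toℕ a) b) (toℕ-rotate (m ∸ toℕ b) a) ⟩
    ((toℕ b + (m ∸ toℕ a)) % m + (toℕ a + (m ∸ toℕ b)) % m) % m
      ≡⟨ sym (%-distribˡ-+ (toℕ b + (m ∸ toℕ a)) (toℕ a + (m ∸ toℕ b)) m) ⟩
    (toℕ b + (m ∸ toℕ a) + (toℕ a + (m ∸ toℕ b))) % m
      ≡⟨ cong (_% m) (regroup (toℕ b) (m ∸ toℕ a) (toℕ a) (m ∸ toℕ b)) ⟩
    ((toℕ a + (m ∸ toℕ a)) + (toℕ b + (m ∸ toℕ b))) % m
      ≡⟨ cong₂ (λ x y → (x + y) % m) (m+[n∸m]≡n (<⇒≤ (Fin.toℕ<n a))) (m+[n∸m]≡n (<⇒≤ (Fin.toℕ<n b))) ⟩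
    (m + m) % m
      ≡⟨ [m+n]%n≡m%n m m ⟩
    m % m
      ≡⟨ n%n≡0 m ⟩
    0 ∎
    where
    open ≡-Reasoning
    regroup : ∀ w x y z → w + x + (y + z) ≡ (y + x) + (w + z)
    regroup = solve-∀

  offset-reversed : ∀ a b → offset b a ≡ toℕ (rotate (suc (toℕ a)) (Fin.opposite b))
  offset-reversed a b = begin
    toℕ (rotate (m ∸ toℕ b) a)                  ≡⟨ toℕ-rotate (m ∸ toℕ b) a ⟩
    (toℕ a + (m ∸ toℕ b)) % m                   ≡⟨ cong (_% m) (begin
      toℕ a + (m ∸ toℕ b)                         ≡⟨ cong (λ x → toℕ a + (x ∸ toℕ b)) (sym (m+[n∸m]≡n (Fin.toℕ<n b))) ⟩
      toℕ a + (suc (toℕ b) + c ∸ toℕ b)           ≡⟨ cong (λ x → toℕ a + (x ∸ toℕ b)) (sym (+-suc (toℕ b) c)) ⟩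
      toℕ a + (toℕ b + suc c ∸ toℕ b)             ≡⟨ cong (toℕ a +_) (m+n∸m≡n (toℕ b) (suc c)) ⟩
      toℕ a + suc c                               ≡⟨ +-comm (toℕ a) (suc c) ⟩
      suc c + toℕ a                               ≡⟨ sym (+-suc c (toℕ a)) ⟩
      c + suc (toℕ a)                             ∎) ⟩
    (c + suc (toℕ a)) % m                       ≡⟨ cong (λ x → (x + suc (toℕ a)) % m) (sym (Fin.opposite-prop b)) ⟩
    (toℕ (Fin.opposite b) + suc (toℕ a)) % m    ≡⟨ sym (toℕ-rotate (suc (toℕ a)) (Fin.opposite b)) ⟩
    toℕ (rotate (suc (toℕ a)) (Fin.opposite b)) ∎
    where
    open ≡-Reasoning
    c : ℕ
    c = m ∸ suc (toℕ b)

  -- a and b are adjacent when (b − a) mod m or (a − b) mod m lies in 1, …, k.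
  circulant : ℕ → SimpleGraph m
  circulant k = record
    { edge        = λ a b → inArc k (offset a b) ∨ inArc k (offset b a)
    ; edge-sym    = λ a b → ∨-comm (inArc k (offset a b)) (inArc k (offset b a))
    ; edge-irrefl = λ a → cong (λ d → inArc k d ∨ inArc k d) (offset-self a)
    }

  deg-circulant : ∀ {k} → k + k < m → ∀ a → deg (circulant k) a ≡ k + k
  deg-circulant {k} k+k<m a = begin
    deg (circulant k) a
      ≡⟨ countFin-∨ (λ b → inArc k (offset a b)) (λ b → inArc k (offset b a)) disjoint ⟩
    countFin (λ b → inArc k (offset a b)) + countFin (λ b → inArc k (offset b a))
      ≡⟨ cong₂ _+_ forward backward ⟩
    k + k ∎
    where
    open ≡-Reasoning
    k<m : k < m
    k<m = ≤-trans (s≤s (m≤m+n k k)) k+k<m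
    arcs : countFin {m} (inArc k ∘ toℕ) ≡ k
    arcs = countFin-inArc k<m
    forward : countFin (λ b → inArc k (offset a b)) ≡ k
    forward = trans (sym (countFin-permute {m} (inArc k ∘ toℕ) (rotation (m∸n≤m m (toℕ a))))) arcs
    backward : countFin (λ b → inArc k (offset b a)) ≡ k
    backward = begin
      countFin (λ b → inArc k (offset b a))
        ≡⟨ countFin-cong (λ b → cong (inArc k) (offset-reversed a b)) ⟩
      countFin (inArc k ∘ toℕ ∘ rotate (suc (toℕ a)) ∘ Fin.opposite)
        ≡⟨ sym (countFin-permute (inArc k ∘ toℕ ∘ rotate (suc (toℕ a))) reverse) ⟩
      countFin (inArc k ∘ toℕ ∘ rotate (suc (toℕ a)))
        ≡⟨ sym (countFin-permute {m} (inArc k ∘ toℕ) (rotation (Fin.toℕ<n a))) ⟩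
      countFin {m} (inArc k ∘ toℕ)
        ≡⟨ arcs ⟩
      k ∎
    -- The two offsets sum to 0 modulo m, which two numbers in 1, …, k cannot do as 2k < m.
    disjoint : ∀ b → inArc k (offset a b) ∧ inArc k (offset b a) ≡ false
    disjoint b with inArc k (offset a b) in arc₁ | inArc k (offset b a) in arc₂
    ... | false | _     = refl
    ... | true  | false = refl
    ... | true  | true  = contradiction (trans (sym (m<n⇒m%n≡m sum<m)) (offset+offset%m≡0 a b)) (>⇒≢ sum>0)
      where
      x y : ℕ
      x = offset a b
      y = offset b a
      sum<m : x + y < m
      sum<m = <-≤-trans (s≤s (+-mono-≤ (proj₂ (inArc⇒ {k} {x} arc₁)) (proj₂ (inArc⇒ {k} {y} arc₂)))) k+k<m
      sum>0 : 0 < x + y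
      sum>0 = ≤-trans (proj₁ (inArc⇒ {k} {x} arc₁)) (m≤m+n x y)

-- A matching avoiding the short jumps of a circulant

Pairs : ℕ → ℕ → ℕ → Set
Pairs h x y = (0 < x × x < suc h) × y ≡ x + h

pairs? : ∀ h x y → Dec (Pairs h x y)
pairs? h x y = (0 <? x ×-dec x <? suc h) ×-dec (y ≟ x + h)

Pairs-irrefl : ∀ {h x} → ¬ Pairs h x x
Pairs-irrefl {h} {x} ((0<x , x<1+h) , x≡x+h) =
  <-irrefl (+-cancelˡ-≡ x 0 h (trans (+-identityʳ x) x≡x+h)) (<-≤-trans 0<x (s≤s⁻¹ x<1+h))

Matched : ℕ → ℕ → ℕ → Set
Matched h x y = Pairs h x y ⊎ Pairs h y x

matched? : ∀ h x y → Dec (Matched h x y)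
matched? h x y = pairs? h x y ⊎-dec pairs? h y x

matching : ∀ h → SimpleGraph (suc (h * 2))
matching h = record
  { edge        = λ a b → does (matched? h (toℕ a) (toℕ b))
  ; edge-sym    = λ a b →
      does-⇔ (mk⇔ ⊎-swap ⊎-swap) (matched? h (toℕ a) (toℕ b)) (matched? h (toℕ b) (toℕ a))
  ; edge-irrefl = λ a → dec-false (matched? h (toℕ a) (toℕ a)) [ Pairs-irrefl , Pairs-irrefl ]
  }

matched⇔ : ∀ {h x} → 0 < x → x ≤ h * 2 → ∃[ p ] p < suc (h * 2) × (∀ y → Matched h x y ⇔ y ≡ p)
matched⇔ {h} {x} 0<x x≤2h with x ≤? h
... | yes x≤h = x + h , s≤s (subst (x + h ≤_) (sym (h*2≡h+h h)) (+-monoˡ-≤ h x≤h)) , λ y → mk⇔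
  (λ { (inj₁ (_ , y≡x+h)) → y≡x+h
     ; (inj₂ ((0<y , _) , x≡y+h)) →
         contradiction (subst (h <_) (sym x≡y+h) (≤-trans (s≤s (m≤n+m h _)) (+-monoˡ-≤ h 0<y))) (≤⇒≯ x≤h) })
  (λ y≡x+h → inj₁ ((0<x , s≤s x≤h) , y≡x+h))
... | no  x≰h = x ∸ h , s≤s (≤-trans (m∸n≤m x h) x≤2h) , λ y → mk⇔
  (λ { (inj₁ ((_ , x<1+h) , _)) → contradiction (s≤s⁻¹ x<1+h) x≰h
     ; (inj₂ (_ , x≡y+h)) → trans (sym (m+n∸n≡m y h)) (cong (_∸ h) (sym x≡y+h)) })
  (λ y≡x∸h → inj₂ ((subst (0 <_) (sym y≡x∸h) (m<n⇒0<n∸m h<x) , subst (_< suc h) (sym y≡x∸h) (s≤s x∸h≤h))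
                  , trans (sym (m∸n+n≡m (<⇒≤ h<x))) (cong (_+ h) (sym y≡x∸h))))
  where
  h<x : h < x
  h<x = ≰⇒> x≰h
  x∸h≤h : x ∸ h ≤ h
  x∸h≤h = subst (x ∸ h ≤_) (m+n∸n≡m h h) (∸-monoˡ-≤ h (subst (x ≤_) (h*2≡h+h h) x≤2h))

deg-matching-zero : ∀ h → deg (matching h) fzero ≡ 0
deg-matching-zero h = countFin-none (edge (matching h) fzero)
  (λ b → dec-false (matched? h 0 (toℕ b)) [ (λ { ((() , _) , _) }) , unmatched (toℕ b) ])
  where
  unmatched : ∀ y → ¬ Pairs h y 0
  unmatched y ((0<y , _) , 0≡y+h) = <⇒≢ (<-≤-trans 0<y (m≤m+n y h)) 0≡y+h

deg-matching-suc : ∀ h a → deg (matching h) (fsuc a) ≡ 1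
deg-matching-suc h a with matched⇔ {h} {suc (toℕ a)} (s≤s z≤n) (Fin.toℕ<n a)
... | p , p<m , matched⇔p = trans
  (countFin-cong {suc (h * 2)} (λ b → does-⇔ (matched⇔p (toℕ b)) (matched? h (suc (toℕ a)) (toℕ b)) (toℕ b ≟ p)))
  (countFin-toℕ≡ p<m)

module _ {h : ℕ} where

  private
    m : ℕ
    m = suc (h * 2)

  offset-matched : ∀ {a b : Fin m} → Pairs h (toℕ a) (toℕ b) → offset a b ≡ h × offset b a ≡ suc h
  offset-matched {a} {b} ((0<x , x<1+h) , y≡x+h) = forward , backward
    where
    open ≡-Reasoning
    x = toℕ a
    h+h≡ : m ≡ suc h + h
    h+h≡ = cong suc (h*2≡h+h h)
    x≤m : x ≤ m
    x≤m = <⇒≤ (Fin.toℕ<n a)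
    forward : offset a b ≡ h
    forward = begin
      offset a b                     ≡⟨ toℕ-rotate (m ∸ x) b ⟩
      (toℕ b + (m ∸ x)) % m          ≡⟨ cong (λ y → (y + (m ∸ x)) % m) y≡x+h ⟩
      (x + h + (m ∸ x)) % m          ≡⟨ cong (_% m) (trans (cong (_+ (m ∸ x)) (+-comm x h)) (+-assoc h x (m ∸ x))) ⟩
      (h + (x + (m ∸ x))) % m        ≡⟨ cong (λ z → (h + z) % m) (m+[n∸m]≡n x≤m) ⟩
      (h + m) % m                    ≡⟨ [m+n]%n≡m%n h m ⟩
      h % m                          ≡⟨ m<n⇒m%n≡m (s≤s (subst (h ≤_) (sym (h*2≡h+h h)) (m≤m+n h h))) ⟩
      h                              ∎
    backward : offset b a ≡ suc h
    backward = begin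
      offset b a                     ≡⟨ toℕ-rotate (m ∸ toℕ b) a ⟩
      (x + (m ∸ toℕ b)) % m          ≡⟨ cong (λ y → (x + (m ∸ y)) % m) y≡x+h ⟩
      (x + (m ∸ (x + h))) % m        ≡⟨ cong (_% m) (sym (+-∸-assoc x x+h≤m)) ⟩
      ((x + m) ∸ (x + h)) % m        ≡⟨ cong (_% m) ([m+n]∸[m+o]≡n∸o x m h) ⟩
      (m ∸ h) % m                    ≡⟨ cong (λ z → (z ∸ h) % m) h+h≡ ⟩
      (suc h + h ∸ h) % m            ≡⟨ cong (_% m) (m+n∸n≡m (suc h) h) ⟩
      suc h % m                      ≡⟨ m<n⇒m%n≡m 1+h<m ⟩
      suc h                          ∎
      where
      x+h≤m : x + h ≤ m
      x+h≤m = subst (x + h ≤_) (sym h+h≡) (≤-trans (+-monoˡ-≤ h (s≤s⁻¹ x<1+h)) (n≤1+n (h + h)))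
      1+h<m : suc h < m
      1+h<m = subst (suc h <_) (sym h+h≡) (m<m+n (suc h) (<-≤-trans 0<x (s≤s⁻¹ x<1+h)))

  circulant∧matching≡false : ∀ {k} → k < h → ∀ a b → edge (circulant k) a b ∧ edge (matching h) a b ≡ false
  circulant∧matching≡false {k} k<h a b with edge (matching h) a b in matched
  ... | false = ∧-zeroʳ (edge (circulant k) a b)
  ... | true  = trans (∧-identityʳ (edge (circulant k) a b))
                      (notInCirculant (does≡true⇒ (matched? h (toℕ a) (toℕ b)) matched))
    where
    k<1+h : k < suc h
    k<1+h = m<n⇒m<1+n k<h
    farApart : ∀ {d d′} → k < d → k < d′ → offset a b ≡ d → offset b a ≡ d′ → edge (circulant k) a b ≡ false
    farApart k<d k<d′ ab≡d ba≡d′ = trans (cong₂ (λ e e′ → inArc k e ∨ inArc k e′) ab≡d ba≡d′)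
                                         (cong₂ _∨_ (inArc-beyond k<d) (inArc-beyond k<d′))
    notInCirculant : Matched h (toℕ a) (toℕ b) → edge (circulant k) a b ≡ false
    notInCirculant (inj₁ pairs) = farApart k<h k<1+h (proj₁ (offset-matched pairs)) (proj₂ (offset-matched pairs))
    notInCirculant (inj₂ pairs) = farApart k<1+h k<h (proj₂ (offset-matched pairs)) (proj₁ (offset-matched pairs))

-- Existence

coneCirculant-inClass : ∀ {m q} → q * 2 ≤ m → InClass (suc (q * 2)) (suc m) (cone (circulant {suc m} q))
coneCirculant-inClass {m} {q} 2q≤m = cone-evenClass (circulant q) (s≤s 2q≤m)
  (∣n⇒∣m*n (suc m) (divides (suc q) refl))
  (λ a → cong suc (trans (deg-circulant (s≤s (subst (_≤ m) (h*2≡h+h q) 2q≤m)) a) (sym (h*2≡h+h q))))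

coneCoCirculant-inClass : ∀ q k → InClass (suc (suc (q * 2))) (suc (suc ((q + k) * 2)))
                                         (cone (complement (circulant {suc (suc ((q + k) * 2))} k)))
coneCoCirculant-inClass q k = cone-evenClass (complement (circulant k))
  (s≤s (s≤s (*-monoˡ-≤ 2 (m≤m+n q k))))
  (∣m⇒∣m*n (suc (suc (suc (q * 2)))) (divides (suc (q + k)) refl))
  (λ a → cong suc (deg-complement≡ (circulant k) a (deg-circulant 2k<m a) (Δ≡ q k)))
  where
  2k<m : k + k < suc (suc ((q + k) * 2))
  2k<m = s≤s (≤-trans (m≤n+m (k + k) (q + q)) (≤-trans (≤-reflexive (regroup q k)) (n≤1+n _)))
    where
    regroup : ∀ q k → q + q + (k + k) ≡ (q + k) * 2
    regroup = solve-∀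
  Δ≡ : ∀ q k → suc (suc ((q + k) * 2)) ≡ suc (k + k + suc (q * 2))
  Δ≡ = solve-∀

coneCoCirculantMatching-inClass : ∀ q k →
  let h = suc (q + k) in
  InClass (suc (suc (q * 2))) (suc (h * 2)) (cone (complement (circulant {suc (h * 2)} k ∪ matching h)))
coneCoCirculantMatching-inClass q k = cone-oddClass X (¬2∣odd*odd h (suc q)) deg₀ nearRegular
  where
  h : ℕ
  h = suc (q + k)
  Y X : SimpleGraph (suc (h * 2))
  Y = circulant k ∪ matching h
  X = complement Y
  k<h : k < h
  k<h = s≤s (m≤n+m k q)
  2k<m : k + k < suc (h * 2)
  2k<m = s≤s (≤-trans (+-mono-≤ (<⇒≤ k<h) (<⇒≤ k<h)) (≤-reflexive (sym (h*2≡h+h h))))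
  degY : ∀ a → deg Y a ≡ k + k + deg (matching h) a
  degY a = trans (deg-∪ (circulant k) (matching h) a (circulant∧matching≡false k<h a))
                 (cong (_+ deg (matching h) a) (deg-circulant 2k<m a))
  deg₀ : deg X fzero ≡ suc (suc (q * 2))
  deg₀ = deg-complement≡ Y fzero (trans (degY fzero) (cong (k + k +_) (deg-matching-zero h))) (Δ≡ q k)
    where
    Δ≡ : ∀ q k → suc (suc (q + k) * 2) ≡ suc (k + k + 0 + suc (suc (q * 2)))
    Δ≡ = solve-∀
  nearRegular : ∀ a → suc (deg X (fsuc a)) ≡ suc (suc (q * 2))
  nearRegular a = cong suc (deg-complement≡ Y (fsuc a)
    (trans (degY (fsuc a)) (cong (k + k +_) (deg-matching-suc h a))) (Δ≡ q k))
    where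
    Δ≡ : ∀ q k → suc (suc (q + k) * 2) ≡ suc (k + k + 1 + suc (q * 2))
    Δ≡ = solve-∀

existence : ∀ δ Δ → 0 < δ → δ ≤ Δ → ∃[ G ] InClass δ Δ G
existence (suc r) (suc m) _ (s≤s r≤m) with parity r | parity m
... | even q | _      = cone (circulant q) , coneCirculant-inClass r≤m
... | odd q  | odd p  with m≤n⇒∃[o]m+o≡n (*-cancelʳ-≤ q p 2 (s≤s⁻¹ r≤m))
...   | k , refl = cone (complement (circulant k)) , coneCoCirculant-inClass q k
existence (suc r) (suc m) _ (s≤s r≤m) | odd q | even p with m≤n⇒∃[o]m+o≡n (*-cancelʳ-< 2 q p r≤m)
...   | k , refl = cone (complement (circulant k ∪ matching (suc (q + k)))) , coneCoCirculantMatching-inClass q k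

proposition2p5 : (δ Δ : ℕ) → 0 < δ → δ ≤ Δ →
    (∃[ G ] InClass δ Δ G)
    × ((G : Graph) → MinDegree G δ → MaxDegree G Δ →
        ((2 ∣ Δ * suc δ) → (Δ * suc δ ≤ 2 * edgeCount G)
                           × ((2 * edgeCount G ≡ Δ * suc δ) ⇔ InClass δ Δ G))
        × ((¬ (2 ∣ Δ * suc δ)) → (suc (Δ * suc δ) ≤ 2 * edgeCount G)
                           × ((2 * edgeCount G ≡ suc (Δ * suc δ)) ⇔ InClass δ Δ G)))
proposition2p5 δ Δ 0<δ δ≤Δ = existence δ Δ 0<δ δ≤Δ , λ G mn mx →
  let open Classification G mn mx in
    (λ 2∣Δ[δ+1]  → Δ[δ+1]≤2|E| , 2|E|≡Δ[δ+1]⇔inClass 2∣Δ[δ+1] 0<δ)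
  , (λ ¬2∣Δ[δ+1] → 1+Δ[δ+1]≤2|E| ¬2∣Δ[δ+1] , 2|E|≡1+Δ[δ+1]⇔inClass ¬2∣Δ[δ+1] 0<δ)
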